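{- Let $a$ and $b$ be odd positive integers. Then there are no positive integers $c,d$ such that $a^2+b^2+c^2=d^2$. -}

module Defs where

open import Data.Nat using (ℕ)
open import Data.Nat.Divisibility using (_∣_)
open import Relation.Nullary using (¬_)

Odd : ℕ → Set
Odd n = ¬ (2 ∣ n)

{-# OPTIONS --safe #-}
module Submission where

-- Squares are 0 or 1 mod 4, and odd squares are 1 mod 4. Hence a² + b² + c²
-- is 2 or 3 mod 4 while d² is not.

open import Defs
open import Data.Nat using (ℕ; zero; suc; _+_; _*_; _^_; _<_; _%_)
open import Data.Nat.Properties using (+-suc; *-comm)
open import Data.Nat.DivMod using ([m+kn]%n≡m%n; m*n%n≡0; %-distribˡ-+)
open import Data.Nat.Divisibility using (divides)
open import Data.Nat.Solver using (module +-*-Solver)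
open import Data.Sum using (_⊎_; inj₁; inj₂)
open import Relation.Binary.PropositionalEquality
  using (_≡_; _≢_; refl; trans; cong; cong₂; subst; module ≡-Reasoning)
open import Relation.Nullary using (¬_; contradiction)
open ≡-Reasoning

data ParityView : ℕ → Set where
  even : ∀ k → ParityView (2 * k)
  odd  : ∀ k → ParityView (1 + 2 * k)

parityView : ∀ n → ParityView n
parityView zero = even 0
parityView (suc n) with parityView n
... | even k = odd k
... | odd k = subst ParityView (cong suc (+-suc k (k + 0))) (even (suc k))

even-square : ∀ k → (2 * k) ^ 2 ≡ (k * k) * 4
even-square = solve 1 (λ k → (con 2 :* k) :^ 2 := (k :* k) :* con 4) refl
  where open +-*-Solver

odd-square : ∀ k → (1 + 2 * k) ^ 2 ≡ 1 + (k + k * k) * 4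
odd-square = solve 1 (λ k → (con 1 :+ con 2 :* k) :^ 2 := con 1 :+ (k :+ k :* k) :* con 4) refl
  where open +-*-Solver

SquareResidue : ℕ → Set
SquareResidue r = r ≡ 0 ⊎ r ≡ 1

square-%4 : ∀ n → SquareResidue (n ^ 2 % 4)
square-%4 n with parityView n
... | even k = inj₁ (trans (cong (_% 4) (even-square k)) (m*n%n≡0 (k * k) 4))
... | odd k = inj₂ (trans (cong (_% 4) (odd-square k)) ([m+kn]%n≡m%n 1 (k + k * k) 4))

odd-square-%4 : ∀ {n} → Odd n → n ^ 2 % 4 ≡ 1
odd-square-%4 {n} n-odd with parityView n
... | even k = contradiction (divides k (*-comm 2 k)) n-odd
... | odd k = trans (cong (_% 4) (odd-square k)) ([m+kn]%n≡m%n 1 (k + k * k) 4)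

odd-squares-sum-%4 : ∀ {a b} → Odd a → Odd b → (a ^ 2 + b ^ 2) % 4 ≡ 2
odd-squares-sum-%4 {a} {b} a-odd b-odd = begin
  (a ^ 2 + b ^ 2) % 4               ≡⟨ %-distribˡ-+ (a ^ 2) (b ^ 2) 4 ⟩
  (a ^ 2 % 4 + b ^ 2 % 4) % 4       ≡⟨ cong₂ (λ r s → (r + s) % 4) (odd-square-%4 a-odd) (odd-square-%4 b-odd) ⟩
  2                                 ∎

¬SquareResidue-[2+r]%4 : ∀ {r} → SquareResidue r → ¬ SquareResidue ((2 + r) % 4)
¬SquareResidue-[2+r]%4 (inj₁ refl) (inj₁ ())
¬SquareResidue-[2+r]%4 (inj₁ refl) (inj₂ ())
¬SquareResidue-[2+r]%4 (inj₂ refl) (inj₁ ())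
¬SquareResidue-[2+r]%4 (inj₂ refl) (inj₂ ())

mainTheorem2 : (a b c d : ℕ) → 0 < a → 0 < b → Odd a → Odd b → 0 < c → 0 < d →
    a ^ 2 + b ^ 2 + c ^ 2 ≢ d ^ 2
mainTheorem2 a b c d _ _ a-odd b-odd _ _ eq =
  ¬SquareResidue-[2+r]%4 (square-%4 c) (subst SquareResidue d²%4≡[2+c²%4]%4 (square-%4 d))
  where
  d²%4≡[2+c²%4]%4 : d ^ 2 % 4 ≡ (2 + c ^ 2 % 4) % 4
  d²%4≡[2+c²%4]%4 = begin
    d ^ 2 % 4                               ≡⟨ cong (_% 4) eq ⟨
    (a ^ 2 + b ^ 2 + c ^ 2) % 4             ≡⟨ %-distribˡ-+ (a ^ 2 + b ^ 2) (c ^ 2) 4 ⟩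
    ((a ^ 2 + b ^ 2) % 4 + c ^ 2 % 4) % 4   ≡⟨ cong (λ r → (r + c ^ 2 % 4) % 4) (odd-squares-sum-%4 a-odd b-odd) ⟩
    (2 + c ^ 2 % 4) % 4                     ∎
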